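{- Let $a_{1}<a_{2}<a_{3}<\cdots$ be a strictly increasing infinite sequence of positive integers, let $A=\{a_{1},a_{2},a_{3},\ldots\}$, and let $n>0$ be an integer such that: (1) whenever $m>n$, there exist indices $i<r\leq s<j$ with $a_{m}=a_{i}+a_{j}=a_{r}+a_{s}$; and (2) whenever $a=a_{i}+a_{j}=a_{r}+a_{s}>a_{n}$ for some indices $i<r<s<j$, then $a=a_{m}$ for some $m>n$. Then $A$ is eventually linear, i.e., there exist integers $N$ and $k\geq 1$ such that for all integers $m>N$, $m\in A$ if and only if $k\mid m$.
   Context: A set $S$ of positive integers is called eventually linear if there exist integers $N$ and $k$ such that for all $m>N$, $m\in S$ if and only if $k$ divides $m$. -}

module Defs where

open import Data.Nat using (ℕ; _<_; _≤_; _>_)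
open import Data.Nat.Divisibility using (_∣_)
open import Data.Product using (Σ; ∃; _×_)
open import Function.Bundles using (_⇔_)
open import Relation.Binary.PropositionalEquality using (_≡_)

RangeFrom1 : (ℕ → ℕ) → ℕ → Set
RangeFrom1 a x = Σ ℕ λ i → (1 ≤ i) × (a i ≡ x)

{-# OPTIONS --safe #-}
-- Condition (2) closes the set A of terms under sums p + q = r + s (p < r < s in A) beyond a_n.
-- By pigeonhole on the larger summands of a_{n+1}, …, a_{2n}, some term c is the larger summand
-- of two different terms y + c and d + c; closure then puts the progression y + t (c + d) into A,
-- and adding progressions puts in all large multiples of some K. Now descend on K. If some large
-- element of A is not divisible by K, following larger summands (condition (1)) and pigeonholing
-- residues gives u < z in A with z ≡ u ≢ 0 (mod K); translating by multiples of K puts a tail of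
-- the class of z into A, and adding such tails gives all large multiples of z mod K, a smaller
-- modulus. Otherwise A eventually consists of the multiples of K; a least counterexample shows
-- that searching a bounded window decides which case occurs.
module Submission where

open import Data.Empty using (⊥)
open import Data.Fin using (Fin; toℕ; fromℕ<)
open import Data.Fin.Properties using (pigeonhole; toℕ<n; toℕ-fromℕ<)
open import Data.Nat
open import Data.Nat.DivMod using (m≡m%n+[m/n]*n; m%n<n; m*n/n≡m; /-monoˡ-≤)
open import Data.Nat.Divisibility using (_∣_; _∣?_; divides; ∣m+n∣m⇒∣n; ∣m∣n⇒∣m+n; n∣m*n; m%n≡0⇒n∣m)
open import Data.Nat.Induction using (<-rec)
open import Data.Nat.Properties
open import Data.Nat.Tactic.RingSolver using (solve-∀)
open import Data.Product using (Σ; ∃; _×_; _,_; proj₁; proj₂)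
open import Data.Sum using (_⊎_; inj₁; inj₂; [_,_]′)
open import Function.Base using (id)
open import Function.Bundles using (_⇔_; mk⇔)
open import Relation.Binary.Definitions using (tri<; tri≈; tri>)
open import Relation.Binary.PropositionalEquality
open import Relation.Nullary using (¬_; Dec; yes; no; contradiction)
open import Relation.Nullary.Decidable using (_×-dec_; ¬?; map′; decidable-stable)
open import Relation.Unary using (Decidable)

open import Defs

o≡m+1+n⇒m<o : ∀ {m o} n → o ≡ m + suc n → m < o
o≡m+1+n⇒m<o {m} n refl = m<m+n m z<s

m+m<n+n⇒m<n : ∀ {m n} → m + m < n + n → m < n
m+m<n+n⇒m<n lt = ≰⇒> λ n≤m → <⇒≱ lt (+-mono-≤ n≤m n≤m)

m≤n<m+m⇒n∸m<m : ∀ {m n} → m ≤ n → n < m + m → n ∸ m < m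
m≤n<m+m⇒n∸m<m {m} m≤n n<m+m = +-cancelˡ-< m _ _ (subst (_< m + m) (sym (m+[n∸m]≡n m≤n)) n<m+m)

m+n≡o+p⇒n≡p+[o∸m] : ∀ {m n o p} → m + n ≡ o + p → m ≤ o → n ≡ p + (o ∸ m)
m+n≡o+p⇒n≡p+[o∸m] {m} {n} {o} {p} eq m≤o = +-cancelˡ-≡ m _ _ (begin
  m + n             ≡⟨ eq ⟩
  o + p             ≡⟨ cong (_+ p) (m+[n∸m]≡n m≤o) ⟨
  m + (o ∸ m) + p   ≡⟨ +-assoc m (o ∸ m) p ⟩
  m + (o ∸ m + p)   ≡⟨ cong (m +_) (+-comm (o ∸ m) p) ⟩
  m + (p + (o ∸ m)) ∎)
  where open ≡-Reasoning

%-≡⇒∣∸ : ∀ x y {d} .{{_ : NonZero d}} → x % d ≡ y % d → d ∣ y ∸ x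
%-≡⇒∣∸ x y {d} same = divides (y / d ∸ x / d) (begin
  y ∸ x                                     ≡⟨ cong₂ _∸_ (m≡m%n+[m/n]*n y d) (m≡m%n+[m/n]*n x d) ⟩
  (y % d + y / d * d) ∸ (x % d + x / d * d) ≡⟨ cong (λ ρ → (y % d + y / d * d) ∸ (ρ + x / d * d)) same ⟩
  (y % d + y / d * d) ∸ (y % d + x / d * d) ≡⟨ [m+n]∸[m+o]≡n∸o (y % d) _ _ ⟩
  y / d * d ∸ x / d * d                     ≡⟨ *-distribʳ-∸ d (y / d) (x / d) ⟨
  (y / d ∸ x / d) * d                       ∎)
  where open ≡-Reasoning

pigeonhole-positive : ∀ {M} (f : ℕ → ℕ) → 0 < M → (∀ {i} → i < M → 0 < f i × f i < M) →
                      Σ ℕ λ i → Σ ℕ λ j → i < j × j < M × f i ≡ f j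
pigeonhole-positive {suc M} f _ bounds =
  let i , j , i<j , same = pigeonhole (n<1+n M) hole
  in  toℕ i , toℕ j , i<j , toℕ<n j ,
      pred-injective {{>-nonZero (proj₁ (bounds (toℕ<n i)))}} {{>-nonZero (proj₁ (bounds (toℕ<n j)))}}
        (trans (sym (toℕ-fromℕ< _)) (trans (cong toℕ same) (toℕ-fromℕ< _)))
  where
  pred< : ∀ {x} → 0 < x × x < suc M → pred x < M
  pred< {suc x} (_ , s≤s x<M) = x<M
  hole : Fin (suc M) → Fin M
  hole σ = fromℕ< (pred< (bounds (toℕ<n σ)))

pigeonhole-pairs : ∀ {M} (f g : ℕ → ℕ) → 0 < M →
                   (∀ {i} → i < M → (0 < f i × f i < M + M) × (0 < g i × g i < M + M) × f i ≢ g i) →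
                   Σ ℕ λ i → Σ ℕ λ i′ → i < M × i′ < M × i ≢ i′ × (f i ≡ f i′ ⊎ f i ≡ g i′ ⊎ g i ≡ g i′)
pigeonhole-pairs {M} f g 0<M bounds =
  let σ , σ′ , σ<σ′ , σ′<2M , same = pigeonhole-positive h (<-≤-trans 0<M (m≤m+n M M)) h-bounds
  in  collision σ σ′ (σ <? M) (σ′ <? M) σ<σ′ σ′<2M same
  where
  choose : ∀ σ → Dec (σ < M) → ℕ
  choose σ (yes _) = f σ
  choose σ (no _)  = g (σ ∸ M)

  h : ℕ → ℕ
  h σ = choose σ (σ <? M)

  h-bounds : ∀ {σ} → σ < M + M → 0 < h σ × h σ < M + M
  h-bounds {σ} σ<2M with σ <? M
  ... | yes σ<M = proj₁ (bounds σ<M)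
  ... | no σ≮M  = proj₁ (proj₂ (bounds (m≤n<m+m⇒n∸m<m (≮⇒≥ σ≮M) σ<2M)))

  collision : ∀ σ σ′ (σ<M? : Dec (σ < M)) (σ′<M? : Dec (σ′ < M)) → σ < σ′ → σ′ < M + M →
              choose σ σ<M? ≡ choose σ′ σ′<M? →
              Σ ℕ λ i → Σ ℕ λ i′ → i < M × i′ < M × i ≢ i′ × (f i ≡ f i′ ⊎ f i ≡ g i′ ⊎ g i ≡ g i′)
  collision σ σ′ (yes σ<M) (yes σ′<M) σ<σ′ _ same = σ , σ′ , σ<M , σ′<M , <⇒≢ σ<σ′ , inj₁ same
  collision σ σ′ (yes σ<M) (no σ′≮M) _ σ′<2M same =
    σ , σ′ ∸ M , σ<M , m≤n<m+m⇒n∸m<m (≮⇒≥ σ′≮M) σ′<2M ,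
    (λ { refl → proj₂ (proj₂ (bounds σ<M)) same }) , inj₂ (inj₁ same)
  collision σ σ′ (no σ≮M) (yes σ′<M) σ<σ′ _ _ = contradiction (<-trans σ<σ′ σ′<M) σ≮M
  collision σ σ′ (no σ≮M) (no σ′≮M) σ<σ′ σ′<2M same =
    σ ∸ M , σ′ ∸ M , m≤n<m+m⇒n∸m<m (≮⇒≥ σ≮M) (<-trans σ<σ′ σ′<2M) , m≤n<m+m⇒n∸m<m (≮⇒≥ σ′≮M) σ′<2M ,
    (λ eq → <⇒≢ σ<σ′ (∸-cancelʳ-≡ (≮⇒≥ σ≮M) (≮⇒≥ σ′≮M) eq)) , inj₂ (inj₂ same)

uniform-bound : (P : ℕ → ℕ → Set) → (∀ {j e e′} → e ≤ e′ → P j e → P j e′) →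
                ∀ M → (∀ {j} → j < M → Σ ℕ (P j)) → Σ ℕ λ E → ∀ {j} → j < M → P j E
uniform-bound P mono zero    _     = 0 , λ ()
uniform-bound P mono (suc M) bound =
  let E , below = uniform-bound P mono M (λ j<M → bound (m<n⇒m<1+n j<M))
      e , at    = bound (n<1+n M)
  in  E + e , λ j<1+M → [ (λ j<M → mono (m≤m+n E e) (below j<M)) , (λ { refl → mono (m≤n+m e E) at }) ]′
                          (m<1+n⇒m<n∨m≡n j<1+M)

module Closure
  (A : ℕ → Set) (c₀ : ℕ)
  (A-positive : ∀ {x} → A x → 0 < x)
  (sum-closed : ∀ {p q r s} → A p → A q → A r → A s →
                p < r → r < s → p + q ≡ r + s → c₀ < p + q → A (p + q))
  where

  sum-closed-sorted : ∀ {p q r s} → A p → A q → A r → A s → p < q → r < s → p ≢ r →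
                      p + q ≡ r + s → c₀ < p + q → A (p + q)
  sum-closed-sorted {p} {q} {r} {s} Ap Aq Ar As p<q r<s p≢r eq c₀< with <-cmp p r
  ... | tri< p<r _ _ = sum-closed Ap Aq Ar As p<r r<s eq c₀<
  ... | tri≈ _ p≡r _ = contradiction p≡r p≢r
  ... | tri> _ _ r<p = subst A (sym eq) (sum-closed Ar As Ap Aq r<p p<q (sym eq) (subst (c₀ <_) eq c₀<))

  private
    sum-closed-sortedˡ : ∀ {p q r s} → A p → A q → A r → A s → p < q → r ≢ s → p ≢ r → p ≢ s →
                         p + q ≡ r + s → c₀ < p + q → A (p + q)
    sum-closed-sortedˡ {r = r} {s} Ap Aq Ar As p<q r≢s p≢r p≢s eq c₀< with <-cmp r s
    ... | tri< r<s _ _ = sum-closed-sorted Ap Aq Ar As p<q r<s p≢r eq c₀<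
    ... | tri≈ _ r≡s _ = contradiction r≡s r≢s
    ... | tri> _ _ s<r = sum-closed-sorted Ap Aq As Ar p<q s<r p≢s (trans eq (+-comm r s)) c₀<

  sum-closed-distinct : ∀ {p q r s} → A p → A q → A r → A s → p ≢ q → r ≢ s → p ≢ r → p ≢ s →
                        p + q ≡ r + s → c₀ < p + q → A (p + q)
  sum-closed-distinct {p} {q} {r} {s} Ap Aq Ar As p≢q r≢s p≢r p≢s eq c₀< with <-cmp p q
  ... | tri< p<q _ _ = sum-closed-sortedˡ Ap Aq Ar As p<q r≢s p≢r p≢s eq c₀<
  ... | tri≈ _ p≡q _ = contradiction p≡q p≢q
  ... | tri> _ _ q<p = subst A (+-comm q p)
    (sum-closed-sortedˡ Aq Ap Ar As q<p r≢s
      (λ { refl → p≢s (+-cancelʳ-≡ q p s (trans eq (+-comm q s))) })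
      (λ { refl → p≢r (+-cancelʳ-≡ q p r eq) })
      (trans (+-comm q p) eq) (subst (c₀ <_) (+-comm p q) c₀<))

  Progression : ℕ → ℕ → Set
  Progression d b = ∀ t → A (b + t * d)

  Tail : ℕ → ℕ → Set
  Tail d b = Σ ℕ λ e → Progression d (b + e * d)

  Multiples : ℕ → ℕ → Set
  Multiples d T = ∀ {x} → T ≤ x → d ∣ x → A x

  EventuallyLinear : Set
  EventuallyLinear = Σ ℕ λ N → Σ ℕ λ k → (1 ≤ k) × (∀ m → m > N → (A m ⇔ (k ∣ m)))

  progression-shift : ∀ {d b} e → Progression d b → Progression d (b + e * d)
  progression-shift {d} {b} e P t = subst A (shift b e t d) (P (e + t))
    where
    shift : ∀ b e t d → b + (e + t) * d ≡ b + e * d + t * d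
    shift = solve-∀

  progression-mono : ∀ {d b e e′} → e ≤ e′ → Progression d (b + e * d) → Progression d (b + e′ * d)
  progression-mono {d} {b} {e} {e′} e≤e′ P =
    subst (Progression d) (trans (+-assoc b _ _) (cong (b +_) merge)) (progression-shift (e′ ∸ e) P)
    where
    merge : e * d + (e′ ∸ e) * d ≡ e′ * d
    merge = trans (sym (*-distribʳ-+ d e (e′ ∸ e))) (cong (_* d) (m+[n∸m]≡n e≤e′))

  tail-reduce : ∀ {d b} m → Tail d (b + m * d) → Tail d b
  tail-reduce {d} {b} m (e , P) = m + e , subst (Progression d) (regroup b m e d) P
    where
    regroup : ∀ b m e d → b + m * d + e * d ≡ b + (m + e) * d
    regroup = solve-∀

  tail-% : ∀ {d b} .{{_ : NonZero d}} → Tail d b → Tail d (b % d)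
  tail-% {d} {b} T = tail-reduce (b / d) (subst (Tail d) (m≡m%n+[m/n]*n b d) T)

  -- With K = suc k, the sum p + (q + (p + 2 + t) K) = (p + K) + (q + (p + 1 + t) K) has its
  -- two representations in increasing order.
  progression-+ : ∀ {k p q} → Progression (suc k) p → Progression (suc k) q → c₀ < q →
                  Progression (suc k) (p + q + (p + 2) * suc k)
  progression-+ {k} {p} {suc q} P Q c₀<q t =
    subst A (total p q t k)
      (sum-closed (P 0) (Q (p + 2 + t)) (P 1) (Q (p + 1 + t))
        (o≡m+1+n⇒m<o k (first-gap p k)) (o≡m+1+n⇒m<o (q + t + (p + t) * k) (second-gap p q t k))
        (balance p q t k) (≤-trans c₀<q (≤-trans (m≤m+n (suc q) _) (m≤n+m _ (p + 0 * suc k)))))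
    where
    balance : ∀ p q t k → p + 0 * suc k + (suc q + (p + 2 + t) * suc k)
                        ≡ p + 1 * suc k + (suc q + (p + 1 + t) * suc k)
    balance = solve-∀
    first-gap : ∀ p k → p + 1 * suc k ≡ p + 0 * suc k + suc k
    first-gap = solve-∀
    second-gap : ∀ p q t k → suc q + (p + 1 + t) * suc k ≡ p + 1 * suc k + suc (q + t + (p + t) * k)
    second-gap = solve-∀
    total : ∀ p q t k → p + 0 * suc k + (suc q + (p + 2 + t) * suc k)
                      ≡ p + suc q + (p + 2) * suc k + t * suc k
    total = solve-∀

  tail-+ : ∀ {k b b′} → Tail (suc k) b → Tail (suc k) b′ → Tail (suc k) (b + b′)
  tail-+ {k} {b} {b′} (e , P) (e′ , P′) =
    e + e′ + suc c₀ + (b + e * suc k + 2) ,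
    subst (Progression (suc k)) (regroup b e b′ e′ c₀ k)
      (progression-+ P (progression-shift (suc c₀) P′) (≤-trans (m≤m*n (suc c₀) (suc k)) (m≤n+m _ _)))
    where
    regroup : ∀ b e b′ e′ c k →
              b + e * suc k + (b′ + e′ * suc k + suc c * suc k) + (b + e * suc k + 2) * suc k
              ≡ b + b′ + (e + e′ + suc c + (b + e * suc k + 2)) * suc k
    regroup = solve-∀

  tail-*suc : ∀ {k b} → Tail (suc k) b → ∀ j → Tail (suc k) (suc j * b)
  tail-*suc {b = b} T zero    = subst (Tail _) (sym (+-identityʳ b)) T
  tail-*suc         T (suc j) = tail-+ T (tail-*suc T j)

  multiples⇒tail : ∀ {k T} → Multiples (suc k) T → Tail (suc k) 0
  multiples⇒tail {k} {T} multiples = T , λ t →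
    multiples (≤-trans (m≤m*n T (suc k)) (m≤m+n _ _))
              (subst (suc k ∣_) (*-distribʳ-+ (suc k) T t) (n∣m*n (T + t)))

  tail⇒multiples : ∀ {k} → Tail (suc k) 0 → Σ ℕ (Multiples (suc k))
  tail⇒multiples {k} (e , P) = e * suc k , from-tail
    where
    from-tail : Multiples (suc k) (e * suc k)
    from-tail e*K≤x (divides q refl) = subst A merge (P (q ∸ e))
      where
      merge : e * suc k + (q ∸ e) * suc k ≡ q * suc k
      merge = trans (sym (*-distribʳ-+ (suc k) e (q ∸ e)))
                    (cong (_* suc k) (m+[n∸m]≡n (*-cancelʳ-≤ e q (suc k) e*K≤x)))

  -- Every t = t % K + (t / K) K, so t ρ lies in the progression indexed by j = t % K.
  progressions⇒multiples : ∀ {k r E} → (∀ {j} → j < suc k → Progression (suc k) (j * suc r + E * suc k)) →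
                           Multiples (suc r) (E * suc k * suc r)
  progressions⇒multiples {k} {r} {E} P E*K*ρ≤x (divides t refl) =
    subst A split (P (m%n<n t K) (t / K * ρ ∸ E))
    where
    open ≡-Reasoning
    K ρ : ℕ
    K = suc k
    ρ = suc r
    E≤t/K*ρ : E ≤ t / K * ρ
    E≤t/K*ρ = ≤-trans (subst (_≤ t / K) (m*n/n≡m E K) (/-monoˡ-≤ K (*-cancelʳ-≤ (E * K) t ρ E*K*ρ≤x)))
                      (m≤m*n (t / K) ρ)
    regroup : ∀ a b c d → a + b * d + c * d ≡ a + (b + c) * d
    regroup = solve-∀
    factor : ∀ j s ρ K → j * ρ + s * ρ * K ≡ (j + s * K) * ρ
    factor = solve-∀
    split : t % K * ρ + E * K + (t / K * ρ ∸ E) * K ≡ t * ρ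
    split = begin
      t % K * ρ + E * K + (t / K * ρ ∸ E) * K ≡⟨ regroup (t % K * ρ) E _ K ⟩
      t % K * ρ + (E + (t / K * ρ ∸ E)) * K   ≡⟨ cong (λ v → t % K * ρ + v * K) (m+[n∸m]≡n E≤t/K*ρ) ⟩
      t % K * ρ + t / K * ρ * K               ≡⟨ factor (t % K) (t / K) ρ K ⟩
      (t % K + t / K * K) * ρ                 ≡⟨ cong (_* ρ) (m≡m%n+[m/n]*n t K) ⟨
      t * ρ                                   ∎

  residue-multiples : ∀ {k r} → Tail (suc k) 0 → Tail (suc k) (suc r) → Σ ℕ (Multiples (suc r))
  residue-multiples {k} {r} T₀ Tρ =
    let E , P = uniform-bound (λ j e → Progression (suc k) (j * suc r + e * suc k))
                              (λ {j} → progression-mono {b = j * suc r}) (suc k) (λ {j} _ → tails j)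
    in  E * suc k * suc r , progressions⇒multiples {E = E} P
    where
    tails : ∀ j → Tail (suc k) (j * suc r)
    tails zero    = T₀
    tails (suc j) = tail-*suc Tρ j

  -- u + ((z ∸ u) + X) = z + X, and both (z ∸ u) + X and X are large multiples of d.
  translate : ∀ {d T u z X} → Multiples d T → A u → A z → u < z → d ∣ z ∸ u →
              d ∣ X → z < X → T ≤ X → c₀ < X → A (z + X)
  translate {u = u} {z} {X} multiples Au Az u<z d∣z∸u d∣X z<X T≤X c₀<X =
    subst A balance
      (sum-closed Au (multiples (≤-trans T≤X (m≤n+m X _)) (∣m∣n⇒∣m+n d∣z∸u d∣X)) Az (multiples T≤X d∣X)
        u<z z<X balance (subst (c₀ <_) (sym balance) (<-≤-trans c₀<X (m≤n+m X z))))
    where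
    balance : u + (z ∸ u + X) ≡ z + X
    balance = trans (sym (+-assoc u (z ∸ u) X)) (cong (_+ X) (m+[n∸m]≡n (<⇒≤ u<z)))

  congruent⇒tail : ∀ {k T u z} → Multiples (suc k) T → A u → A z → u < z → suc k ∣ z ∸ u →
                   Tail (suc k) z
  congruent⇒tail {k} {T} {z = z} multiples Au Az u<z K∣z∸u = M , λ t →
    subst A (trans (cong (z +_) (*-distribʳ-+ (suc k) M t)) (sym (+-assoc z _ _)))
      (translate multiples Au Az u<z K∣z∸u (n∣m*n (M + t))
        (<-≤-trans z<M (M≤ t)) (≤-trans T≤M (M≤ t)) (<-≤-trans c₀<M (M≤ t)))
    where
    M : ℕ
    M = suc (z + T + c₀)
    M≤ : ∀ t → M ≤ (M + t) * suc k
    M≤ t = ≤-trans (m≤m+n M t) (m≤m*n (M + t) (suc k))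
    z<M : z < M
    z<M = s≤s (≤-trans (m≤m+n z T) (m≤m+n (z + T) c₀))
    T≤M : T ≤ M
    T≤M = ≤-trans (m≤n+m T z) (≤-trans (m≤m+n (z + T) c₀) (n≤1+n _))
    c₀<M : c₀ < M
    c₀<M = s≤s (m≤n+m c₀ (z + T))

  progression⇒multiples : ∀ {d b} → 0 < d → Progression d b → Σ ℕ λ k → Σ ℕ (Multiples (suc k))
  progression⇒multiples {suc k} {b} _ P =
    k , tail⇒multiples (tail-reduce b (subst (Tail (suc k)) (*-comm (suc k) b)
                         (tail-*suc (0 , subst (Progression (suc k)) (sym (+-identityʳ b)) P) k)))

  record SharedSummand : Set where
    field
      y c d  : ℕ
      y∈A    : A y
      c∈A    : A c
      d∈A    : A d
      y+c∈A  : A (y + c)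
      c+d∈A  : A (c + d)
      y≤c    : y ≤ c
      d≤c    : d ≤ c
      y≢d    : y ≢ d
      c₀<c+d : c₀ < c + d

  -- With w = c + d, the identities (P + c) + d = P + w and (P + c) + w = (P + w) + c
  -- pass from P, P + c ∈ A to P + w, P + w + c ∈ A.
  shared-summand⇒progression : (S : SharedSummand) → let open SharedSummand S in Progression (c + d) y
  shared-summand⇒progression S t = proj₁ (along t)
    where
    open SharedSummand S
    w : ℕ
    w = c + d

    c<w : c < w
    c<w = m<m+n c (A-positive d∈A)

    Pair : ℕ → Set
    Pair P = A P × A (P + c)

    apart : ∀ {P} → P ≡ y ⊎ w < P → P ≢ w × P ≢ d × P + c ≢ w
    apart (inj₁ refl) = <⇒≢ (≤-<-trans y≤c c<w) , y≢d ,
                        λ y+c≡w → y≢d (+-cancelʳ-≡ c y d (trans y+c≡w (+-comm c d)))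
    apart (inj₂ w<P)  = >⇒≢ w<P , >⇒≢ (<-trans (m<n+m d (A-positive c∈A)) w<P) ,
                        >⇒≢ (<-≤-trans w<P (m≤m+n _ c))

    extend : ∀ {P} → Pair P → P ≢ w × P ≢ d × P + c ≢ w → Pair (P + w)
    extend {P} (AP , AP+c) (P≢w , P≢d , P+c≢w) = AP+w , subst A (shuffle P c w) AP+c+w
      where
      0<P : 0 < P
      0<P = A-positive AP
      shuffle : ∀ P c w → P + c + w ≡ P + w + c
      shuffle = solve-∀
      AP+w : A (P + w)
      AP+w = sum-closed-distinct AP c+d∈A AP+c d∈A P≢w (>⇒≢ (≤-<-trans d≤c (m<n+m c 0<P)))
               (<⇒≢ (m<m+n P (A-positive c∈A))) P≢d (sym (+-assoc P c d)) (<-≤-trans c₀<c+d (m≤n+m w P))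
      AP+c+w : A (P + c + w)
      AP+c+w = sum-closed-distinct AP+c c+d∈A AP+w c∈A P+c≢w (>⇒≢ (<-≤-trans c<w (m≤n+m w P)))
                 (<⇒≢ (+-monoʳ-< P c<w)) (>⇒≢ (m<n+m c 0<P)) (shuffle P c w)
                 (<-≤-trans c₀<c+d (m≤n+m w (P + c)))

    origin : ∀ t → y + t * w ≡ y ⊎ w < y + t * w
    origin zero    = inj₁ (+-identityʳ y)
    origin (suc t) = inj₂ (<-≤-trans (m<n+m w (A-positive y∈A)) (+-monoʳ-≤ y (m≤m+n w (t * w))))

    along : ∀ t → Pair (y + t * w)
    along zero    = subst Pair (sym (+-identityʳ y)) (y∈A , y+c∈A)
    along (suc t) = subst Pair (step y t w) (extend (along t) (apart (origin t)))
      where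
      step : ∀ y t w → y + t * w + w ≡ y + suc t * w
      step = solve-∀

  record Decomposition (x : ℕ) : Set where
    field
      p q r s : ℕ
      p∈A     : A p
      q∈A     : A q
      r∈A     : A r
      s∈A     : A s
      p<r     : p < r
      r≤s     : r ≤ s
      s<q     : s < q
      x≡p+q   : x ≡ p + q
      x≡r+s   : x ≡ r + s

    p<q : p < q
    p<q = <-≤-trans p<r (≤-trans r≤s (<⇒≤ s<q))

  module Descent
    (A? : Decidable A)
    (decompose : ∀ {x} → A x → c₀ < x → Decomposition x)
    where

    Bad : ℕ → ℕ → Set
    Bad d x = A x × ¬ d ∣ x

    bad? : ∀ d → Decidable (Bad d)
    bad? d x = A? x ×-dec ¬? (d ∣? x)

    ¬bad⇒∣ : ∀ {d x} → A x → ¬ Bad d x → d ∣ x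
    ¬bad⇒∣ {d} {x} Ax ¬bad = decidable-stable (d ∣? x) (λ d∤x → ¬bad (Ax , d∤x))

    CongruentPair : ℕ → Set
    CongruentPair d = Σ ℕ λ u → Σ ℕ λ z → A u × Bad d z × u < z × d ∣ z ∸ u

    SmallerModulus : ℕ → Set
    SmallerModulus k = Σ ℕ λ r → r < k × Σ ℕ (Multiples (suc r))

    congruent⇒smaller-modulus : ∀ {k T} → Multiples (suc k) T → CongruentPair (suc k) → SmallerModulus k
    congruent⇒smaller-modulus {k} multiples (u , z , Au , (Az , K∤z) , u<z , K∣z∸u) with z % suc k in z%K
    ... | zero  = contradiction (m%n≡0⇒n∣m z (suc k) z%K) K∤z
    ... | suc r = r , ≤-pred (subst (_< suc k) z%K (m%n<n z (suc k))) ,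
                  residue-multiples (multiples⇒tail multiples)
                    (subst (Tail (suc k)) z%K (tail-% (congruent⇒tail multiples Au Az u<z K∣z∸u)))

    descend : ∀ {d x} → Bad d x → c₀ < x → CongruentPair d ⊎ Σ ℕ λ x′ → Bad d x′ × x′ < x × x < x′ + x′
    descend {d} {x} (Ax , d∤x) c₀<x = split (d ∣? q)
      where
      open Decomposition (decompose Ax c₀<x)
      split : Dec (d ∣ q) → CongruentPair d ⊎ Σ ℕ λ x′ → Bad d x′ × x′ < x × x < x′ + x′
      split (yes d∣q) = inj₁ (p , x , p∈A , (Ax , d∤x) ,
                              subst (p <_) (sym x≡p+q) (m<m+n p (A-positive q∈A)) ,
                              subst (d ∣_) (sym (trans (cong (_∸ p) x≡p+q) (m+n∸m≡n p q))) d∣q)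
      split (no d∤q)  = inj₂ (q , (q∈A , d∤q) ,
                              subst (q <_) (sym x≡p+q) (m<n+m q (A-positive p∈A)) ,
                              subst (_< q + q) (sym x≡p+q) (+-monoˡ-< q p<q))

    record BadChain (d F x : ℕ) : Set where
      field
        f          : ℕ → ℕ
        head       : f 0 ≡ x
        bad        : ∀ {i} → i ≤ F → Bad d (f i)
        descending : ∀ {i j} → i < j → j ≤ F → f j < f i

    chain-cons : ∀ {d F x x′} → Bad d x → x′ < x → BadChain d F x′ → BadChain d (suc F) x
    chain-cons {d} {F} {x} {x′} bx x′<x C = record
      { f = f′ ; head = refl ; bad = bad′ ; descending = descending′ }
      where
      open BadChain C
      f′ : ℕ → ℕ
      f′ zero    = x
      f′ (suc i) = f i
      below-head : ∀ {j} → j ≤ F → f j ≤ x′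
      below-head {zero}  _   = ≤-reflexive head
      below-head {suc j} j≤F = ≤-trans (<⇒≤ (descending z<s j≤F)) (≤-reflexive head)
      bad′ : ∀ {i} → i ≤ suc F → Bad d (f′ i)
      bad′ {zero}  _         = bx
      bad′ {suc i} (s≤s i≤F) = bad i≤F
      descending′ : ∀ {i j} → i < j → j ≤ suc F → f′ j < f′ i
      descending′ {zero}  {suc j} _         (s≤s j≤F) = ≤-<-trans (below-head j≤F) x′<x
      descending′ {suc i} {suc j} (s≤s i<j) (s≤s j≤F) = descending i<j j≤F

    -- Each step at least halves, so 2 ^ F c₀ < x keeps all F + 1 members above c₀.
    bad-chain : ∀ {d x} F → Bad d x → 2 ^ F * c₀ < x → CongruentPair d ⊎ BadChain d F x
    bad-chain {x = x} zero bx _ = inj₂ (record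
      { f = λ _ → x ; head = refl ; bad = λ _ → bx
      ; descending = λ i<j j≤0 → contradiction (<-≤-trans i<j j≤0) n≮0 })
    bad-chain {x = x} (suc F) bx big
      with descend bx (≤-<-trans (m≤n*m c₀ (2 ^ suc F) {{m^n≢0 2 (suc F)}}) big)
    ... | inj₁ pair = inj₁ pair
    ... | inj₂ (x′ , bx′ , x′<x , x<x′+x′)
      with bad-chain F bx′ (m+m<n+n⇒m<n (<-trans (subst (_< x) (double (2 ^ F) c₀) big) x<x′+x′))
      where
      double : ∀ m c → 2 * m * c ≡ m * c + m * c
      double = solve-∀
    ...   | inj₁ pair  = inj₁ pair
    ...   | inj₂ chain = inj₂ (chain-cons bx x′<x chain)

    chain⇒congruent : ∀ {k x} → BadChain (suc k) k x → CongruentPair (suc k)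
    chain⇒congruent {k} C =
      let i , j , i<j , j<K , same = pigeonhole-positive (λ i → f i % suc k) z<s residue-bounds
          j≤k = ≤-pred j<K
      in  f j , f i , proj₁ (bad j≤k) , bad (≤-trans (<⇒≤ i<j) j≤k) , descending i<j j≤k ,
          %-≡⇒∣∸ (f j) (f i) (sym same)
      where
      open BadChain C
      residue-bounds : ∀ {i} → i < suc k → 0 < f i % suc k × f i % suc k < suc k
      residue-bounds {i} i<K =
        n≢0⇒n>0 (λ rem≡0 → proj₂ (bad (≤-pred i<K)) (m%n≡0⇒n∣m (f i) (suc k) rem≡0)) , m%n<n (f i) (suc k)

    bad⇒congruent : ∀ {k x} → Bad (suc k) x → 2 ^ k * c₀ < x → CongruentPair (suc k)
    bad⇒congruent {k} bx big = [ id , chain⇒congruent ]′ (bad-chain k bx big)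

    module Window {k T} (multiples : Multiples (suc k) T) (L : ℕ) (T≤L : T ≤ L) (c₀≤L : c₀ ≤ L) where
      K X W : ℕ
      K = suc k
      X = suc L * K
      W = suc (L + X)

      L<X : L < X
      L<X = m≤m*n (suc L) K

      -- If z = p + q = r + s is a least bad element above L with z ≥ W, then q and s lie in (L, z),
      -- so K divides them; hence r is bad, r ≤ L, and r + X is a smaller bad element above L.
      least-bad-below-W : ∀ {z} → Bad K z → W ≤ z → (∀ {x} → L < x → x < z → ¬ Bad K x) → ⊥
      least-bad-below-W {z} (Az , K∤z) W≤z least = least L<r+X r+X<z (Ar+X , K∤r+X)
        where
        L<z : L < z
        L<z = <-≤-trans (s≤s (m≤m+n L X)) W≤z
        open Decomposition (decompose Az (≤-<-trans c₀≤L L<z))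
        L+L<z : L + L < z
        L+L<z = <-≤-trans (s≤s (+-monoʳ-≤ L (<⇒≤ L<X))) W≤z
        L<q : L < q
        L<q = m+m<n+n⇒m<n (<-trans L+L<z (subst (_< q + q) (sym x≡p+q) (+-monoˡ-< q p<q)))
        L<s : L < s
        L<s = m+m<n+n⇒m<n (<-≤-trans L+L<z (subst (_≤ s + s) (sym x≡r+s) (+-monoˡ-≤ s r≤s)))
        K∣q : K ∣ q
        K∣q = ¬bad⇒∣ q∈A (least L<q (subst (q <_) (sym x≡p+q) (m<n+m q (A-positive p∈A))))
        K∣s : K ∣ s
        K∣s = ¬bad⇒∣ s∈A (least L<s (subst (s <_) (sym x≡r+s) (m<n+m s (A-positive r∈A))))
        K∤r : ¬ K ∣ r
        K∤r K∣r = K∤z (subst (K ∣_) (sym x≡r+s) (∣m∣n⇒∣m+n K∣r K∣s))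
        r≤L : r ≤ L
        r≤L = ≮⇒≥ λ L<r → least L<r (subst (r <_) (sym x≡r+s) (m<m+n r (A-positive s∈A))) (r∈A , K∤r)
        K∣r∸p : K ∣ r ∸ p
        K∣r∸p = ∣m+n∣m⇒∣n (subst (K ∣_) (m+n≡o+p⇒n≡p+[o∸m] (trans (sym x≡p+q) x≡r+s) (<⇒≤ p<r)) K∣q) K∣s
        Ar+X : A (r + X)
        Ar+X = translate multiples p∈A r∈A p<r K∣r∸p (n∣m*n (suc L))
                 (≤-<-trans r≤L L<X) (≤-trans T≤L (<⇒≤ L<X)) (≤-<-trans c₀≤L L<X)
        K∤r+X : ¬ K ∣ r + X
        K∤r+X K∣r+X = K∤r (∣m+n∣m⇒∣n (subst (K ∣_) (+-comm r X) K∣r+X) (n∣m*n (suc L)))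
        L<r+X : L < r + X
        L<r+X = <-≤-trans L<X (m≤n+m X r)
        r+X<z : r + X < z
        r+X<z = <-≤-trans (s≤s (+-monoˡ-≤ X r≤L)) W≤z

      no-bad-above : (∀ {x} → L < x → x < W → ¬ Bad K x) → ∀ {x} → L < x → ¬ Bad K x
      no-bad-above none-below-W {x} = <-rec (λ z → L < z → ¬ Bad K z) no-bad x
        where
        no-bad : ∀ z → (∀ {y} → y < z → L < y → ¬ Bad K y) → L < z → ¬ Bad K z
        no-bad z below L<z bz with z <? W
        ... | yes z<W = none-below-W L<z z<W bz
        ... | no z≮W  = least-bad-below-W bz (≮⇒≥ z≮W) (λ L<y y<z → below y<z L<y)

    step : ∀ {k T} → Multiples (suc k) T → EventuallyLinear ⊎ SmallerModulus k
    step {k} {T} multiples = decide (anyUpTo? (λ x → (L <? x) ×-dec bad? K x) W)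
      where
      L : ℕ
      L = T + 2 ^ k * c₀
      open Window multiples L (m≤m+n T _) (≤-trans (m≤n*m c₀ (2 ^ k) {{m^n≢0 2 k}}) (m≤n+m _ T))
      decide : Dec (∃ λ x → x < W × L < x × Bad K x) → EventuallyLinear ⊎ SmallerModulus k
      decide (yes (x , _ , L<x , bx)) =
        inj₂ (congruent⇒smaller-modulus multiples (bad⇒congruent bx (≤-<-trans (m≤n+m _ T) L<x)))
      decide (no none) = inj₁ (L , K , s≤s z≤n , λ m L<m → mk⇔
        (λ Am → ¬bad⇒∣ Am (no-bad-above (λ L<x x<W bx → none (_ , x<W , L<x , bx)) L<m))
        (multiples (≤-trans (m≤m+n T _) (<⇒≤ L<m))))

    eventually-linear : ∀ k {T} → Multiples (suc k) T → EventuallyLinear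
    eventually-linear = <-rec _ descend-modulus
      where
      descend-modulus : ∀ k → (∀ {r} → r < k → ∀ {T} → Multiples (suc r) T → EventuallyLinear) →
                        ∀ {T} → Multiples (suc k) T → EventuallyLinear
      descend-modulus k smaller multiples with step multiples
      ... | inj₁ done                       = done
      ... | inj₂ (r , r<k , _ , multiples′) = smaller r<k multiples′

module Sequence
  (a : ℕ → ℕ) (n : ℕ)
  (positive : ∀ i → 1 ≤ i → 0 < a i)
  (increasing : ∀ i j → 1 ≤ i → i < j → a i < a j)
  (0<n : 0 < n)
  (decomposable : ∀ m → m > n → Σ ℕ λ i → Σ ℕ λ r → Σ ℕ λ s → Σ ℕ λ j →
     (1 ≤ i) × (i < r) × (r ≤ s) × (s < j) × (a m ≡ a i + a j) × (a m ≡ a r + a s))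
  (closed : ∀ x i r s j → 1 ≤ i → i < r → r < s → s < j
     → x ≡ a i + a j → x ≡ a r + a s → x > a n
     → Σ ℕ λ m → (m > n) × (x ≡ a m))
  where

  A : ℕ → Set
  A = RangeFrom1 a

  a-reflects-< : ∀ {i j} → 1 ≤ i → 1 ≤ j → a i < a j → i < j
  a-reflects-< {i} {j} 1≤i 1≤j ai<aj with <-cmp i j
  ... | tri< i<j _ _ = i<j
  ... | tri≈ _ refl _ = contradiction ai<aj (<-irrefl refl)
  ... | tri> _ _ j<i = contradiction (increasing j i 1≤j j<i) (<-asym ai<aj)

  a-mono-≤ : ∀ {i j} → 1 ≤ i → i ≤ j → a i ≤ a j
  a-mono-≤ {i} {j} 1≤i i≤j with m≤n⇒m<n∨m≡n i≤j
  ... | inj₁ i<j  = <⇒≤ (increasing i j 1≤i i<j)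
  ... | inj₂ refl = ≤-refl

  a-injective : ∀ {i j} → 1 ≤ i → 1 ≤ j → a i ≡ a j → i ≡ j
  a-injective {i} {j} 1≤i 1≤j ai≡aj with <-cmp i j
  ... | tri< i<j _ _ = contradiction ai≡aj (<⇒≢ (increasing i j 1≤i i<j))
  ... | tri≈ _ i≡j _ = i≡j
  ... | tri> _ _ j<i = contradiction ai≡aj (>⇒≢ (increasing j i 1≤j j<i))

  index≤term : ∀ {i} → 1 ≤ i → i ≤ a i
  index≤term {suc zero}    _ = positive 1 ≤-refl
  index≤term {suc (suc i)} _ =
    ≤-<-trans (index≤term {suc i} (s≤s z≤n)) (increasing (suc i) (suc (suc i)) (s≤s z≤n) ≤-refl)

  A? : Decidable A
  A? x = map′ (λ (i , _ , 1≤i , ai≡x) → i , 1≤i , ai≡x)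
              (λ (i , 1≤i , ai≡x) → i , s≤s (subst (i ≤_) ai≡x (index≤term 1≤i)) , 1≤i , ai≡x)
              (anyUpTo? (λ i → (1 ≤? i) ×-dec (a i ≟ x)) (suc x))

  A-positive : ∀ {x} → A x → 0 < x
  A-positive (i , 1≤i , refl) = positive i 1≤i

  A-sum-closed : ∀ {p q r s} → A p → A q → A r → A s →
                 p < r → r < s → p + q ≡ r + s → a n < p + q → A (p + q)
  A-sum-closed (i , 1≤i , refl) (j , 1≤j , refl) (r , 1≤r , refl) (s , 1≤s , refl) ai<ar ar<as sums an<sum =
    let m , n<m , sum≡am = closed (a i + a j) i r s j 1≤i (a-reflects-< 1≤i 1≤r ai<ar)
                             (a-reflects-< 1≤r 1≤s ar<as) (a-reflects-< 1≤s 1≤j as<aj) refl sums an<sum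
    in  m , ≤-trans 0<n (<⇒≤ n<m) , sym sum≡am
    where
    as<aj : a s < a j
    as<aj = +-cancelˡ-< (a r) _ _ (subst (_< a r + a j) sums (+-monoˡ-< (a j) ai<ar))

  open Closure A (a n) A-positive A-sum-closed public

  A-decompose : ∀ {x} → A x → a n < x → Decomposition x
  A-decompose (m , 1≤m , refl) an<am
    with i , r , s , j , 1≤i , i<r , r≤s , s<j , e₁ , e₂ ← decomposable m (a-reflects-< 0<n 1≤m an<am)
    = record
      { p = a i ; q = a j ; r = a r ; s = a s
      ; p∈A = i , 1≤i , refl ; q∈A = j , 1≤j , refl ; r∈A = r , 1≤r , refl ; s∈A = s , 1≤s , refl
      ; p<r = increasing i r 1≤i i<r ; r≤s = a-mono-≤ 1≤r r≤s ; s<q = increasing s j 1≤s s<j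
      ; x≡p+q = e₁ ; x≡r+s = e₂ }
    where
    1≤r : 1 ≤ r
    1≤r = ≤-trans 1≤i (<⇒≤ i<r)
    1≤s : 1 ≤ s
    1≤s = ≤-trans 1≤r r≤s
    1≤j : 1 ≤ j
    1≤j = ≤-trans 1≤s (<⇒≤ s<j)

  open Descent A? A-decompose public

  record Split (m : ℕ) : Set where
    field
      small big : ℕ
      1≤small   : 1 ≤ small
      small≤big : small ≤ big
      big<m     : big < m
      a-split   : a m ≡ a small + a big

  split : ∀ {m i j} → 1 ≤ m → 1 ≤ i → i ≤ j → a m ≡ a i + a j → Split m
  split {i = i} {j} 1≤m 1≤i i≤j am≡ai+aj = record
    { small = i ; big = j ; 1≤small = 1≤i ; small≤big = i≤j ; a-split = am≡ai+aj
    ; big<m = a-reflects-< (≤-trans 1≤i i≤j) 1≤m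
                (subst (a j <_) (sym am≡ai+aj) (m<n+m (a j) (positive i 1≤i))) }

  splits : ∀ e → Σ (Split (suc n + e)) λ S → Σ (Split (suc n + e)) λ S′ → Split.big S ≢ Split.big S′
  splits e with i , r , s , j , 1≤i , i<r , r≤s , s<j , e₁ , e₂ ← decomposable (suc n + e) (s≤s (m≤m+n n e))
    = split (s≤s z≤n) 1≤i (<⇒≤ (<-trans i<r (≤-<-trans r≤s s<j))) e₁ ,
      split (s≤s z≤n) (≤-trans 1≤i (<⇒≤ i<r)) r≤s e₂ ,
      λ j≡s → <⇒≢ s<j (sym j≡s)

  first second : ∀ e → Split (suc n + e)
  first e  = proj₁ (splits e)
  second e = proj₁ (proj₂ (splits e))

  split-bounds : ∀ {e} → e < n → (S : Split (suc n + e)) → 0 < Split.big S × Split.big S < n + n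
  split-bounds e<n S = ≤-trans 1≤small small≤big , <-≤-trans big<m (+-monoʳ-< n e<n)
    where open Split S

  shared-summand-of : ∀ {e e′} → e ≢ e′ → (S : Split (suc n + e)) (S′ : Split (suc n + e′)) →
                      Split.big S ≡ Split.big S′ → SharedSummand
  shared-summand-of {e} {e′} e≢e′ S S′ same-big = record
    { y = a S.small ; c = a S.big ; d = a S′.small
    ; y∈A = S.small , S.1≤small , refl
    ; c∈A = S.big , ≤-trans S.1≤small S.small≤big , refl
    ; d∈A = S′.small , S′.1≤small , refl
    ; y+c∈A = suc n + e , s≤s z≤n , S.a-split
    ; c+d∈A = suc n + e′ , s≤s z≤n , sym c+d≡am′
    ; y≤c = a-mono-≤ S.1≤small S.small≤big
    ; d≤c = subst (λ b → a S′.small ≤ a b) (sym same-big) (a-mono-≤ S′.1≤small S′.small≤big)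
    ; y≢d = λ y≡d → e≢e′ (+-cancelˡ-≡ (suc n) e e′ (a-injective (s≤s z≤n) (s≤s z≤n)
              (trans S.a-split (trans (cong₂ _+_ y≡d (cong a same-big)) (sym S′.a-split)))))
    ; c₀<c+d = subst (a n <_) (sym c+d≡am′) (increasing n (suc n + e′) 0<n (s≤s (m≤m+n n e′)))
    }
    where
    module S = Split S
    module S′ = Split S′
    c+d≡am′ : a S.big + a S′.small ≡ a (suc n + e′)
    c+d≡am′ = trans (+-comm (a S.big) (a S′.small))
                    (trans (cong (λ b → a S′.small + a b) same-big) (sym S′.a-split))

  shared-summand : SharedSummand
  shared-summand =
    let e , e′ , _ , _ , e≢e′ , collision = pigeonhole-pairs big₁ big₂ 0<n bounds
    in  [ shared-summand-of e≢e′ (first e) (first e′)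
        , [ shared-summand-of e≢e′ (first e) (second e′) , shared-summand-of e≢e′ (second e) (second e′) ]′
        ]′ collision
    where
    big₁ big₂ : ℕ → ℕ
    big₁ e = Split.big (first e)
    big₂ e = Split.big (second e)
    bounds : ∀ {e} → e < n → (0 < big₁ e × big₁ e < n + n) × (0 < big₂ e × big₂ e < n + n) × big₁ e ≢ big₂ e
    bounds e<n = split-bounds e<n (first _) , split-bounds e<n (second _) , proj₂ (proj₂ (splits _))

mainTheorem1 : (a : ℕ → ℕ) (n : ℕ)
    → (∀ i → 1 ≤ i → 0 < a i)
    → (∀ i j → 1 ≤ i → i < j → a i < a j)
    → 0 < n
    → (∀ m → m > n → Σ ℕ λ i → Σ ℕ λ r → Σ ℕ λ s → Σ ℕ λ j →
         (1 ≤ i) × (i < r) × (r ≤ s) × (s < j) × (a m ≡ a i + a j) × (a m ≡ a r + a s))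
    → (∀ x i r s j → 1 ≤ i → i < r → r < s → s < j
         → x ≡ a i + a j → x ≡ a r + a s → x > a n
         → Σ ℕ λ m → (m > n) × (x ≡ a m))
    → Σ ℕ λ N → Σ ℕ λ k → (1 ≤ k) × (∀ m → m > N → (RangeFrom1 a m ⇔ (k ∣ m)))
mainTheorem1 a n positive increasing 0<n decomposable closed =
  let k , _ , multiples = progression⇒multiples (A-positive c+d∈A) (shared-summand⇒progression shared-summand)
  in  eventually-linear k multiples
  where
  open Sequence a n positive increasing 0<n decomposable closed
  open SharedSummand shared-summand
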